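{- Let $X$ be a partially oriented graph whose underlying graph $U(X)$ is local tournament orientable. Then $X$ is an obstruction if and only if $X$ contains exactly two arcs $(a,b),(c,d)$, these two arcs are opposing in $X$, and for every vertex $v\in V(X)\setminus\{a,b,c,d\}$ the arcs $(a,b),(c,d)$ are not opposing in $X-v$. Moreover, if $X$ is an obstruction with arcs $(a,b),(c,d)$, then every $\Gamma$-sequence in $Z(U(X))$ from $(a,b)$ to $(d,c)$ includes all vertices of $X$ (every vertex of $X$ occurs in some pair of the sequence).
   Context: A partially oriented graph $H=(V,E\cup A)$ is obtained from a simple graph $G$ (its underlying graph $U(H)=G$) by orienting the edges of some subset of $E(G)$: $E$ is the set of unoriented edges $uv$ and $A$ the set of arcs $(u,v)$ (tail $u$, head $v$). $H-v$ denotes deletion of vertex $v$. A local tournament is an oriented graph (no loops, at most one arc between any two vertices) in which the in-neighbourhood and the out-neighbourhood of every vertex each induce a tournament. A graph is local tournament orientable if it has an orientation that is a local tournament. $H$ can be completed to a local tournament if one can orient every edge of $E$ so that the result is a local tournament. An obstruction is a partially oriented graph $X$ such that: $X$ cannot be completed to a local tournament; for each vertex $v$, $X-v$ can; and for each arc $(u,v)$, the partially oriented graph obtained by replacing $(u,v)$ with the unoriented edge $uv$ can. For a graph $G$, let $Z(G)=\{(u,v): uv\in E(G)\}$. For $(u,v),(x,y)\in Z(G)$, $(u,v)$ forces $(x,y)$, written $(u,v)\Gamma(x,y)$, if either $u=x$ and $v=y$; or $u=y$, $v\neq x$ and $vx\notin E(G)$; or $v=x$, $u\neq y$ and $uy\notin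 E(G)$. A $\Gamma$-sequence from $(u,v)$ to $(x,y)$ is a sequence $(u_1,v_1)\Gamma(u_2,v_2)\Gamma\cdots\Gamma(u_k,v_k)$ of pairs in $Z(G)$ with $(u_1,v_1)=(u,v)$, $(u_k,v_k)=(x,y)$; write $(u,v)\Gamma^*(x,y)$ if one exists. Two arcs $(a,b),(c,d)$ of a partially oriented graph $H$ are opposing in $H$ if $(a,b)\Gamma^*(d,c)$ in $Z(U(H))$. -}

module Defs where

open import Data.Bool using (Bool; true; false; T; _∧_; _∨_; not)
open import Data.Empty using (⊥)
open import Data.Unit using (⊤)
open import Data.Nat using (ℕ; zero; suc)
open import Data.Fin using (Fin; punchIn; _≟_)
open import Data.Fin.Properties using (punchIn-injective)
open import Data.Product using (Σ; ∃; _×_; _,_; proj₁; proj₂)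
open import Data.Sum using (_⊎_)
open import Data.List using (List; []; _∷_; [_])
open import Data.List.Relation.Unary.Any using (Any)
open import Relation.Nullary using (¬_)
open import Relation.Nullary.Decidable using (⌊_⌋)
open import Relation.Binary.PropositionalEquality using (_≡_; _≢_; refl; cong)

record Graph (n : ℕ) : Set where
  field
    adj    : Fin n → Fin n → Bool
    sym    : ∀ u v → T (adj u v) → T (adj v u)
    irrefl : ∀ u → ¬ T (adj u u)
open Graph public

-- Partially oriented graphs H = (V, E ∪ A).
-- 'edge' is the underlying simple graph U(H); arc u v means (u,v) ∈ A.
-- An edge uv with neither arc u v nor arc v u is an unoriented edge (∈ E).

record POGraph (n : ℕ) : Set where
  field
    edge     : Graph n
    arc      : Fin n → Fin n → Bool
    arc⇒adj  : ∀ u v → T (arc u v) → T (adj edge u v)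
    arc-asym : ∀ u v → T (arc u v) → ¬ T (arc v u)
open POGraph public

U : ∀ {n} → POGraph n → Graph n
U X = edge X

IsOrientation : ∀ {n} → Graph n → (Fin n → Fin n → Bool) → Set
IsOrientation {n} G O =
  (∀ (u v : Fin n) → T (adj G u v) → T (O u v) ⊎ T (O v u)) ×
  (∀ (u v : Fin n) → T (O u v) → T (adj G u v)) ×
  (∀ (u v : Fin n) → T (O u v) → ¬ T (O v u))

IsLocalTournament : ∀ {n} → (Fin n → Fin n → Bool) → Set
IsLocalTournament {n} O =
  (∀ (x u w : Fin n) → T (O u x) → T (O w x) → u ≢ w → T (O u w ∨ O w u)) ×
  (∀ (x u w : Fin n) → T (O x u) → T (O x w) → u ≢ w → T (O u w ∨ O w u))

LTOrientable : ∀ {n} → Graph n → Set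
LTOrientable {n} G =
  Σ (Fin n → Fin n → Bool) λ O → IsOrientation G O × IsLocalTournament O

Completable : ∀ {n} → POGraph n → Set
Completable {n} H =
  Σ (Fin n → Fin n → Bool) λ O →
    IsOrientation (U H) O ×
    (∀ (u v : Fin n) → T (arc H u v) → T (O u v)) ×
    IsLocalTournament O

-- Vertex deletion H - v (vertices of H - v are Fin n, embedded by punchIn v)

private
  T-∧ˡ : ∀ {a b} → T (a ∧ b) → T a
  T-∧ˡ {true} _ = _

deleteG : ∀ {n} → Graph (suc n) → Fin (suc n) → Graph n
deleteG G v = record
  { adj    = λ x y → adj G (punchIn v x) (punchIn v y)
  ; sym    = λ x y → sym G (punchIn v x) (punchIn v y)
  ; irrefl = λ x → irrefl G (punchIn v x)
  }

_-_ : ∀ {n} → POGraph (suc n) → Fin (suc n) → POGraph n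
H - v = record
  { edge     = deleteG (edge H) v
  ; arc      = λ x y → arc H (punchIn v x) (punchIn v y)
  ; arc⇒adj  = λ x y → arc⇒adj H (punchIn v x) (punchIn v y)
  ; arc-asym = λ x y → arc-asym H (punchIn v x) (punchIn v y)
  }

unorient : ∀ {n} → POGraph n → Fin n → Fin n → POGraph n
unorient H a b = record
  { edge     = edge H
  ; arc      = arc′
  ; arc⇒adj  = λ x y p → arc⇒adj H x y (T-∧ˡ p)
  ; arc-asym = λ x y p q → arc-asym H x y (T-∧ˡ p) (T-∧ˡ q)
  }
  where
  arc′ : _ → _ → Bool
  arc′ x y = arc H x y ∧ not (⌊ x ≟ a ⌋ ∧ ⌊ y ≟ b ⌋)

DeletionsCompletable : ∀ {n} → POGraph n → Set
DeletionsCompletable {zero}  H = ⊤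
DeletionsCompletable {suc n} H = ∀ (v : Fin (suc n)) → Completable (H - v)

record Obstruction {n : ℕ} (X : POGraph n) : Set where
  field
    not-completable  : ¬ Completable X
    vertex-minimal   : DeletionsCompletable X
    arc-minimal      : ∀ (u v : Fin n) → T (arc X u v) → Completable (unorient X u v)

Pair : ℕ → Set
Pair n = Fin n × Fin n

InZ : ∀ {n} → Graph n → Pair n → Set
InZ G (u , v) = T (adj G u v)

Forces : ∀ {n} → Graph n → Pair n → Pair n → Set
Forces G (u , v) (x , y) =
  (u ≡ x × v ≡ y) ⊎
  (u ≡ y × v ≢ x × ¬ T (adj G v x)) ⊎
  (v ≡ x × u ≢ y × ¬ T (adj G u y))

data GSeq {n : ℕ} (G : Graph n) : Pair n → Pair n → List (Pair n) → Set where
  single : ∀ {p} → InZ G p → GSeq G p p [ p ]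
  step   : ∀ {p q r ps} → InZ G p → Forces G p q → GSeq G q r ps →
           GSeq G p r (p ∷ ps)

Γ* : ∀ {n} → Graph n → Pair n → Pair n → Set
Γ* G p q = ∃ λ ps → GSeq G p q ps

Opposing : ∀ {n} → POGraph n → Fin n → Fin n → Fin n → Fin n → Set
Opposing H a b c d = Γ* (U H) (a , b) (d , c)

ExactlyTwoArcs : ∀ {n} → POGraph n → Fin n → Fin n → Fin n → Fin n → Set
ExactlyTwoArcs {n} H a b c d =
  T (arc H a b) × T (arc H c d) × ¬ ((a , b) ≡ (c , d)) ×
  (∀ (x y : Fin n) → T (arc H x y) → (x , y) ≡ (a , b) ⊎ (x , y) ≡ (c , d))

-- for every v ∉ {a,b,c,d}, the arcs (a,b),(c,d) are not opposing in H - v.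
-- (In H - v, the vertex a is the a′ with punchIn v a′ ≡ a, which exists iff a ≢ v.)
NotOpposingAfterDeletion : ∀ {n} → POGraph n → Fin n → Fin n → Fin n → Fin n → Set
NotOpposingAfterDeletion {zero}  H a b c d = ⊤
NotOpposingAfterDeletion {suc n} H a b c d =
  ∀ (v : Fin (suc n)) (a′ b′ c′ d′ : Fin n) →
    punchIn v a′ ≡ a → punchIn v b′ ≡ b → punchIn v c′ ≡ c → punchIn v d′ ≡ d →
    ¬ Opposing (H - v) a′ b′ c′ d′

Occurs : ∀ {n} → Fin n → List (Pair n) → Set
Occurs w ps = Any (λ p → w ≡ proj₁ p ⊎ w ≡ proj₂ p) ps

{-# OPTIONS --safe #-}
module Submission where

-- An orientation is a local tournament exactly when it is closed under forcing. So if U(H) has a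
-- local tournament orientation O₀ and no arc of H forces the reverse of an arc, H is completed by
-- orienting the Γ*-closure of its arcs as forced and every other edge as in O₀; the closure is
-- computed by iterating one forcing step over the finitely many pairs until nothing new appears.
-- Hence an obstruction has two opposing arcs and no others (unorienting a third arc would leave
-- them opposing), and no X - v keeps them opposing; conversely each such X is an obstruction, and
-- a Γ-sequence between the two arcs that avoided w would survive in X - w.

open import Defs
open import Data.Bool using (Bool; T; _∨_)
open import Data.Bool.Properties using (T-≡; T-∧; T-∨; ∨-comm)
open import Data.Empty using (⊥-elim)
open import Data.Unit using (tt)
open import Data.Nat using (ℕ; zero; suc; _≤_; _<_; z≤n)
open import Data.Nat.Properties using (≤-trans; ≤-<-trans; 1+n≰n)
open import Data.Fin using (Fin; punchIn; punchOut; _≟_; remQuot; combine)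
open import Data.Fin.Properties using (any?; punchIn-injective; punchIn-punchOut; remQuot-combine)
open import Data.Fin.Subset using (Subset; _∈_; ∣_∣)
open import Data.Fin.Subset.Properties using (∣p∣≤n; p⊂q⇒∣p∣<∣q∣)
open import Data.Vec using (tabulate)
open import Data.Vec.Properties using (lookup∘tabulate; []=⇒lookup; lookup⇒[]=)
open import Data.Product using (Σ; ∃; ∃₂; _×_; _,_; proj₁; proj₂; uncurry; swap; map)
open import Data.Product.Properties using (≡-dec; ,-injective)
open import Data.Sum using (_⊎_; inj₁; inj₂)
import Data.Sum as Sum
open import Data.List.Relation.Unary.Any using (here; there)
import Data.List.Relation.Unary.Any as Any
open import Function using (_∘_; flip)
open import Function.Bundles using (_⇔_; mk⇔; Equivalence)
open import Relation.Binary.Construct.Closure.ReflexiveTransitive using (Star; ε; _◅_; _◅◅_)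
open import Relation.Nullary using (¬_; Dec; yes; no; contradiction)
open import Relation.Nullary.Decidable
  using (⌊_⌋; map′; toWitness; fromWitness; decidable-stable; _×-dec_; _⊎-dec_; ¬?; T?)
open import Relation.Binary.PropositionalEquality
  using (_≡_; _≢_; refl; cong; cong₂; subst; trans) renaming (sym to ≡-sym)

open Equivalence using (to; from)

private
  variable
    n : ℕ

-- Reachability in a finite type

module FiniteReachability
  {A : Set} {m : ℕ} (enum : Fin m → A) (enum-onto : ∀ a → ∃ λ i → enum i ≡ a)
  where

  ∃? : {P : A → Set} → (∀ a → Dec (P a)) → Dec (∃ P)
  ∃? {P} P? = map′ (λ (i , p) → enum i , p) pull (any? (P? ∘ enum))
    where
    pull : ∃ P → ∃ (P ∘ enum)
    pull (a , p) with enum-onto a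
    ... | i , refl = i , p

  Increasing : (ℕ → A → Bool) → Set
  Increasing S = ∀ k {a} → T (S k a) → T (S (suc k) a)

  StableAt : (ℕ → A → Bool) → ℕ → Set
  StableAt S k = ∀ {a} → T (S (suc k) a) → T (S k a)

  private
    ⟦_⟧ : (A → Bool) → Subset m
    ⟦ f ⟧ = tabulate (f ∘ enum)

    ∈⟦⟧⇔ : ∀ {f i} → i ∈ ⟦ f ⟧ ⇔ T (f (enum i))
    ∈⟦⟧⇔ {f} {i} = mk⇔
      (λ i∈ → from T-≡ (trans (≡-sym (lookup∘tabulate (f ∘ enum) i)) ([]=⇒lookup i∈)))
      (λ t → lookup⇒[]= i _ (trans (lookup∘tabulate (f ∘ enum) i) (to T-≡ t)))

  module _ (S : ℕ → A → Bool) (increasing : Increasing S) where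

    private
      grows : ∀ k {a} → T (S (suc k) a) → ¬ T (S k a) → ∣ ⟦ S k ⟧ ∣ < ∣ ⟦ S (suc k) ⟧ ∣
      grows k {a} new old with enum-onto a
      ... | i , refl = p⊂q⇒∣p∣<∣q∣
        ( (λ i∈ → from (∈⟦⟧⇔ {S (suc k)}) (increasing k (to (∈⟦⟧⇔ {S k}) i∈)))
        , i , from (∈⟦⟧⇔ {S (suc k)}) new , old ∘ to (∈⟦⟧⇔ {S k}) )

      stable-or-large : ∀ k → ∃ (StableAt S) ⊎ k ≤ ∣ ⟦ S k ⟧ ∣
      stable-or-large zero = inj₂ z≤n
      stable-or-large (suc k)
        with stable-or-large k | ∃? (λ a → T? (S (suc k) a) ×-dec ¬? (T? (S k a)))
      ... | inj₁ stable | _                   = inj₁ stable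
      ... | inj₂ k≤∣S∣  | yes (_ , new , old) = inj₂ (≤-<-trans k≤∣S∣ (grows k new old))
      ... | inj₂ _      | no none             =
        inj₁ (k , λ {a} new → decidable-stable (T? (S k a)) (λ old → none (a , new , old)))

    increasing-stabilises : ∃ (StableAt S)
    increasing-stabilises with stable-or-large (suc m)
    ... | inj₁ stable = stable
    ... | inj₂ m<∣S∣  = contradiction (≤-trans m<∣S∣ (∣p∣≤n ⟦ S (suc m) ⟧)) 1+n≰n

  module Reachability
    (Step : A → A → Set) (step? : ∀ a b → Dec (Step a b)) (seed : A → Bool)
    where

    private
      Extended : (A → Bool) → A → Set
      Extended R b = T (R b) ⊎ ∃ λ a → T (R a) × Step a b

      extended? : ∀ R b → Dec (Extended R b)
      extended? R b = T? (R b) ⊎-dec ∃? (λ a → T? (R a) ×-dec step? a b)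

      stage : ℕ → A → Bool
      stage zero      = seed
      stage (suc k) b = ⌊ extended? (stage k) b ⌋

      stage-increasing : Increasing stage
      stage-increasing k t = fromWitness (inj₁ t)

      seed⊆stage : ∀ k {a} → T (seed a) → T (stage k a)
      seed⊆stage zero    t = t
      seed⊆stage (suc k) t = stage-increasing k (seed⊆stage k t)

      stage-sound : ∀ k {b} → T (stage k b) → ∃ λ a → T (seed a) × Star Step a b
      stage-sound zero    t = _ , t , ε
      stage-sound (suc k) {b} t with toWitness {a? = extended? (stage k) b} t
      ... | inj₁ t′ = stage-sound k t′
      ... | inj₂ (a , t′ , a⟶b) with stage-sound k t′
      ...   | s , seed-s , s⟶⋆a = s , seed-s , s⟶⋆a ◅◅ (a⟶b ◅ ε)

      stable : ∃ (StableAt stage)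
      stable = increasing-stabilises stage stage-increasing

    -- Opaque, so that unification never unfolds the iteration behind it.
    opaque
      reachable : A → Bool
      reachable = stage (proj₁ stable)

      seed⊆reachable : ∀ {a} → T (seed a) → T (reachable a)
      seed⊆reachable = seed⊆stage (proj₁ stable)

      reachable-closed : ∀ {a b} → T (reachable a) → Step a b → T (reachable b)
      reachable-closed t a⟶b = proj₂ stable (fromWitness (inj₂ (_ , t , a⟶b)))

      reachable-sound : ∀ {b} → T (reachable b) → ∃ λ a → T (seed a) × Star Step a b
      reachable-sound = stage-sound (proj₁ stable)

Holds : (Fin n → Fin n → Bool) → Pair n → Set
Holds R p = T (uncurry R p)

Arc : POGraph n → Pair n → Set
Arc H = Holds (arc H)

Incident : Fin n → Pair n → Set
Incident w p = w ≡ proj₁ p ⊎ w ≡ proj₂ p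

module _ (G : Graph n) where

  InZ-swap : ∀ {p} → InZ G p → InZ G (swap p)
  InZ-swap = sym G _ _

  Forces-swap : ∀ {p q} → Forces G p q → Forces G (swap q) (swap p)
  Forces-swap (inj₁ (refl , refl))         = inj₁ (refl , refl)
  Forces-swap (inj₂ (inj₁ (e , ne , na))) = inj₂ (inj₁ (≡-sym e , ne ∘ ≡-sym , na ∘ sym G _ _))
  Forces-swap (inj₂ (inj₂ (e , ne , na))) = inj₂ (inj₂ (≡-sym e , ne ∘ ≡-sym , na ∘ sym G _ _))

  GSeq-first∈Z : ∀ {p q ps} → GSeq G p q ps → InZ G p
  GSeq-first∈Z (single z)   = z
  GSeq-first∈Z (step z _ _) = z

  GSeq-last∈Z : ∀ {p q ps} → GSeq G p q ps → InZ G q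
  GSeq-last∈Z (single z)   = z
  GSeq-last∈Z (step _ _ s) = GSeq-last∈Z s

  GSeq-Γ*-trans : ∀ {p q r ps} → GSeq G p q ps → Γ* G q r → Γ* G p r
  GSeq-Γ*-trans (single _)   qr = qr
  GSeq-Γ*-trans (step z f s) qr = _ , step z f (proj₂ (GSeq-Γ*-trans s qr))

  Γ*-trans : ∀ {p q r} → Γ* G p q → Γ* G q r → Γ* G p r
  Γ*-trans (_ , s) = GSeq-Γ*-trans s

  GSeq-swap : ∀ {p q ps} → GSeq G p q ps → Γ* G (swap q) (swap p)
  GSeq-swap (single z)   = _ , single (InZ-swap z)
  GSeq-swap (step z f s) =
    Γ*-trans (GSeq-swap s) (_ , step (InZ-swap (GSeq-first∈Z s)) (Forces-swap f) (single (InZ-swap z)))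

  Γ*-swap : ∀ {p q} → Γ* G p q → Γ* G (swap q) (swap p)
  Γ*-swap (_ , s) = GSeq-swap s

  ForceStep : Pair n → Pair n → Set
  ForceStep p q = Forces G p q × InZ G q

  forces? : ∀ p q → Dec (Forces G p q)
  forces? (u , v) (x , y) =
    ((u ≟ x) ×-dec (v ≟ y)) ⊎-dec
    ((u ≟ y) ×-dec ¬? (v ≟ x) ×-dec ¬? (T? (adj G v x))) ⊎-dec
    ((v ≟ x) ×-dec ¬? (u ≟ y) ×-dec ¬? (T? (adj G u y)))

  forceStep? : ∀ p q → Dec (ForceStep p q)
  forceStep? p q = forces? p q ×-dec T? (uncurry (adj G) q)

  Star⇒Γ* : ∀ {p q} → InZ G p → Star ForceStep p q → Γ* G p q
  Star⇒Γ* z ε                = _ , single z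
  Star⇒Γ* z ((f , z′) ◅ rest) = _ , step z f (proj₂ (Star⇒Γ* z′ rest))

  Occurs-first : ∀ {w p q ps} → GSeq G p q ps → Incident w p → Occurs w ps
  Occurs-first (single _)   = here
  Occurs-first (step _ _ _) = here

  Occurs-last : ∀ {w p q ps} → GSeq G p q ps → Incident w q → Occurs w ps
  Occurs-last (single _)   = here
  Occurs-last (step _ _ s) = there ∘ Occurs-last s

punchIn² : Fin (suc n) → Pair n → Pair (suc n)
punchIn² w = map (punchIn w) (punchIn w)

punchIn²-injective : ∀ (w : Fin (suc n)) {p q} → punchIn² w p ≡ punchIn² w q → p ≡ q
punchIn²-injective w e with ,-injective e
... | e₁ , e₂ = cong₂ _,_ (punchIn-injective w _ _ e₁) (punchIn-injective w _ _ e₂)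

punchIn²-onto : ∀ {w : Fin (suc n)} {p} → ¬ Incident w p → ∃ λ p′ → punchIn² w p′ ≡ p
punchIn²-onto w∉p =
  (punchOut (w∉p ∘ inj₁) , punchOut (w∉p ∘ inj₂)) ,
  cong₂ _,_ (punchIn-punchOut _) (punchIn-punchOut _)

module _ (G : Graph (suc n)) (w : Fin (suc n)) where

  Forces-delete : ∀ {p q} → Forces G (punchIn² w p) (punchIn² w q) → Forces (deleteG G w) p q
  Forces-delete (inj₁ (e₁ , e₂)) =
    inj₁ (punchIn-injective w _ _ e₁ , punchIn-injective w _ _ e₂)
  Forces-delete (inj₂ (inj₁ (e , ne , na))) =
    inj₂ (inj₁ (punchIn-injective w _ _ e , ne ∘ cong (punchIn w) , na))
  Forces-delete (inj₂ (inj₂ (e , ne , na))) =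
    inj₂ (inj₂ (punchIn-injective w _ _ e , ne ∘ cong (punchIn w) , na))

  GSeq-delete : ∀ {p q ps} → GSeq G p q ps → ¬ Occurs w ps →
                ∀ {p′ q′} → punchIn² w p′ ≡ p → punchIn² w q′ ≡ q → Γ* (deleteG G w) p′ q′
  GSeq-delete (single z) _ {p′} refl e =
    subst (Γ* (deleteG G w) p′) (punchIn²-injective w (≡-sym e)) (_ , single z)
  GSeq-delete (step z f s) w∉ refl e with punchIn²-onto (w∉ ∘ there ∘ Occurs-first G s)
  ... | r′ , refl = _ , step z (Forces-delete f) (proj₂ (GSeq-delete s (w∉ ∘ there) refl e))

restrict-LTOrientable : ∀ {G : Graph (suc n)} v → LTOrientable G → LTOrientable (deleteG G v)
restrict-LTOrientable v (O , (total , ⊆adj , asym) , (inLT , outLT)) =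
  (λ x y → O (punchIn v x) (punchIn v y)) ,
  ((λ x y → total (punchIn v x) (punchIn v y)) ,
   (λ x y → ⊆adj (punchIn v x) (punchIn v y)) ,
   (λ x y → asym (punchIn v x) (punchIn v y))) ,
  ((λ x u w o₁ o₂ u≢w → inLT (punchIn v x) _ _ o₁ o₂ (u≢w ∘ punchIn-injective v u w)) ,
   (λ x u w o₁ o₂ u≢w → outLT (punchIn v x) _ _ o₁ o₂ (u≢w ∘ punchIn-injective v u w)))

-- Forcing-closed orientations

ForcingClosed : Graph n → (Fin n → Fin n → Bool) → Set
ForcingClosed G O = ∀ {p q} → Forces G p q → InZ G q → Holds O p → Holds O q

module _ {G : Graph n} {O : Fin n → Fin n → Bool} (orientation : IsOrientation G O) where

  private
    total = proj₁ orientation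
    ⊆adj  = proj₁ (proj₂ orientation)
    asym  = proj₂ (proj₂ orientation)

    oriented⇒adjacent : ∀ u w → T (O u w ∨ O w u) → T (adj G u w)
    oriented⇒adjacent u w t with to T-∨ t
    ... | inj₁ o = ⊆adj u w o
    ... | inj₂ o = sym G w u (⊆adj w u o)

    adjacent⇒oriented : ∀ u w → T (adj G u w) → T (O u w ∨ O w u)
    adjacent⇒oriented u w e = from T-∨ (total u w e)

  localTournament⇒forcingClosed : IsLocalTournament O → ForcingClosed G O
  localTournament⇒forcingClosed _ (inj₁ (refl , refl)) _ o = o
  localTournament⇒forcingClosed (_ , outLT) {u , v} {x , _} (inj₂ (inj₁ (refl , v≢x , v≁x))) z o
    with total x u z
  ... | inj₁ o′ = o′
  ... | inj₂ o′ = ⊥-elim (v≁x (oriented⇒adjacent v x (outLT u v x o o′ v≢x)))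
  localTournament⇒forcingClosed (inLT , _) {u , v} {_ , y} (inj₂ (inj₂ (refl , u≢y , u≁y))) z o
    with total v y z
  ... | inj₁ o′ = o′
  ... | inj₂ o′ = ⊥-elim (u≁y (oriented⇒adjacent u y (inLT v u y o o′ u≢y)))

  forcingClosed⇒localTournament : ForcingClosed G O → IsLocalTournament O
  forcingClosed⇒localTournament closed = inLT , outLT
    where
    inLT : ∀ x u w → T (O u x) → T (O w x) → u ≢ w → T (O u w ∨ O w u)
    inLT x u w ux wx u≢w with T? (adj G u w)
    ... | yes e  = adjacent⇒oriented u w e
    ... | no u≁w = ⊥-elim (asym w x wx
      (closed {u , x} (inj₂ (inj₂ (refl , u≢w , u≁w))) (sym G w x (⊆adj w x wx)) ux))

    outLT : ∀ x u w → T (O x u) → T (O x w) → u ≢ w → T (O u w ∨ O w u)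
    outLT x u w xu xw u≢w with T? (adj G u w)
    ... | yes e  = adjacent⇒oriented u w e
    ... | no u≁w = ⊥-elim (asym x w xw
      (closed {x , u} (inj₂ (inj₁ (refl , u≢w , u≁w))) (sym G x w (⊆adj x w xw)) xu))

forcingClosed-GSeq : ∀ {G : Graph n} {O} → ForcingClosed G O →
                     ∀ {p q ps} → GSeq G p q ps → Holds O p → Holds O q
forcingClosed-GSeq closed (single _)             o = o
forcingClosed-GSeq closed (step {q = q} _ f s) o =
  forcingClosed-GSeq closed s (closed {q = q} f (GSeq-first∈Z _ s) o)

flip-orientation : ∀ {G : Graph n} {O} → IsOrientation G O → IsOrientation G (flip O)
flip-orientation {G = G} (total , ⊆adj , asym) =
  (λ u v e → Sum.swap (total u v e)) , (λ u v o → sym G v u (⊆adj v u o)) , (λ u v → asym v u)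

flip-localTournament : ∀ {O : Fin n → Fin n → Bool} → IsLocalTournament O → IsLocalTournament (flip O)
flip-localTournament {O = O} (inLT , outLT) =
  (λ x u w o₁ o₂ u≢w → subst T (∨-comm (O u w) (O w u)) (outLT x u w o₁ o₂ u≢w)) ,
  (λ x u w o₁ o₂ u≢w → subst T (∨-comm (O u w) (O w u)) (inLT x u w o₁ o₂ u≢w))

¬Γ*-swap : ∀ {G : Graph n} → LTOrientable G → ∀ {p} → ¬ Γ* G p (swap p)
¬Γ*-swap {G = G} (O , orientation@(total , _ , asym) , lt) {a , b} (_ , s)
  with total a b (GSeq-first∈Z G s)
... | inj₁ o = asym a b o (forcingClosed-GSeq closed s o)
  where
  closed = localTournament⇒forcingClosed {G = G} {O = O} orientation lt
... | inj₂ o = asym b a o (forcingClosed-GSeq closed s o)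
  where
  closed = localTournament⇒forcingClosed {G = G} {O = flip O}
             (flip-orientation {G = G} orientation) (flip-localTournament lt)

Completable⇒¬Opposing : ∀ (H : POGraph n) → Completable H →
                        ∀ {p q} → Arc H p → Arc H q → ¬ Γ* (U H) p (swap q)
Completable⇒¬Opposing H (O , orientation@(_ , _ , asym) , arcs⊆O , lt) {a , b} {c , d} ab cd (_ , s) =
  asym c d (arcs⊆O c d cd) (forcingClosed-GSeq closed s (arcs⊆O a b ab))
  where closed = localTournament⇒forcingClosed {G = U H} {O = O} orientation lt

-- Completions

OpposingArcs : POGraph n → Set
OpposingArcs H = ∃₂ λ p q → Arc H p × Arc H q × Γ* (U H) p (swap q)

module Completion (H : POGraph n) where

  private
    G = U H

    pairs-onto : ∀ p → ∃ λ i → remQuot {n} n i ≡ p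
    pairs-onto (x , y) = combine x y , remQuot-combine x y

  open FiniteReachability (remQuot {n} n) pairs-onto
  open Reachability (ForceStep G) (forceStep? G) (uncurry (arc H))

  Forced : Pair n → Set
  Forced p = T (reachable p)

  forced⇒Γ* : ∀ {q} → Forced q → ∃ λ p → Arc H p × Γ* G p q
  forced⇒Γ* f with reachable-sound f
  ... | p , p-arc , p⟶⋆q = p , p-arc , Star⇒Γ* G (arc⇒adj H _ _ p-arc) p⟶⋆q

  forced⇒InZ : ∀ {q} → Forced q → InZ G q
  forced⇒InZ f = GSeq-last∈Z G (proj₂ (proj₂ (proj₂ (forced⇒Γ* f))))

  completion : LTOrientable G → (∀ {p} → Forced p → ¬ Forced (swap p)) → Completable H
  completion (O₀ , orientation₀@(total₀ , ⊆adj₀ , asym₀) , lt₀) consistent =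
    O , orientation , (λ x y xy → intro {x , y} (inj₁ (seed⊆reachable xy))) ,
    forcingClosed⇒localTournament {G = G} {O = O} orientation closed
    where
    Extends : Pair n → Set
    Extends p = Forced p ⊎ (Holds O₀ p × ¬ Forced (swap p))

    extends? : ∀ p → Dec (Extends p)
    extends? p = T? (reachable p) ⊎-dec (T? (uncurry O₀ p) ×-dec ¬? (T? (reachable (swap p))))

    O : Fin n → Fin n → Bool
    O x y = ⌊ extends? (x , y) ⌋

    intro : ∀ {p} → Extends p → Holds O p
    intro = fromWitness

    elim : ∀ {p} → Holds O p → Extends p
    elim {p} = toWitness {a? = extends? p}

    total : ∀ x y → T (adj G x y) → T (O x y) ⊎ T (O y x)
    total x y e = orient (T? (reachable (x , y))) (T? (reachable (y , x))) (total₀ x y e)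
      where
      orient : Dec (Forced (x , y)) → Dec (Forced (y , x)) →
               T (O₀ x y) ⊎ T (O₀ y x) → T (O x y) ⊎ T (O y x)
      orient (yes f) _       _        = inj₁ (intro (inj₁ f))
      orient (no _)  (yes f) _        = inj₂ (intro (inj₁ f))
      orient (no ¬f) (no ¬f̄) (inj₁ o) = inj₁ (intro (inj₂ (o , ¬f̄)))
      orient (no ¬f) (no ¬f̄) (inj₂ o) = inj₂ (intro (inj₂ (o , ¬f)))

    ⊆adj : ∀ x y → T (O x y) → T (adj G x y)
    ⊆adj x y o with elim o
    ... | inj₁ f       = forced⇒InZ f
    ... | inj₂ (o₀ , _) = ⊆adj₀ x y o₀

    asym : ∀ x y → T (O x y) → ¬ T (O y x)
    asym x y o o′ with elim o | elim o′
    ... | inj₁ f        | inj₁ f′        = consistent f f′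
    ... | inj₁ f        | inj₂ (_ , ¬f)  = ¬f f
    ... | inj₂ (_ , ¬f′) | inj₁ f′        = ¬f′ f′
    ... | inj₂ (o₀ , _)  | inj₂ (o₀′ , _) = asym₀ x y o₀ o₀′

    orientation : IsOrientation G O
    orientation = total , ⊆adj , asym

    -- A forced swap q would force swap p, which the O₀-part of O p rules out.
    closed : ForcingClosed G O
    closed {p} {q} f z o with elim o
    ... | inj₁ fp        = intro (inj₁ (reachable-closed fp (f , z)))
    ... | inj₂ (o₀ , ¬f̄) = intro (inj₂
      ( localTournament⇒forcingClosed {G = G} {O = O₀} orientation₀ lt₀ {p} {q} f z o₀
      , λ f̄ → ¬f̄ (reachable-closed f̄ (Forces-swap G f , InZ-swap G {p} (⊆adj₀ _ _ o₀)))))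

  completable-or-opposing : LTOrientable G → Completable H ⊎ OpposingArcs H
  completable-or-opposing lto
    with ∃? (λ p → T? (reachable p) ×-dec T? (reachable (swap p)))
  ... | no consistent = inj₁ (completion lto (λ f f̄ → consistent (_ , f , f̄)))
  ... | yes (_ , f , f̄) with forced⇒Γ* f | forced⇒Γ* f̄
  ...   | p , p-arc , p⟶⋆r | q , q-arc , q⟶⋆r̄ =
    inj₂ (p , q , p-arc , q-arc , Γ*-trans G p⟶⋆r (Γ*-swap G q⟶⋆r̄))

open Completion using (completable-or-opposing)

ArcsWithin : POGraph n → Pair n → Pair n → Set
ArcsWithin {n} X P Q = ∀ (x y : Fin n) → T (arc X x y) → (x , y) ≡ P ⊎ (x , y) ≡ Q

TwoMinimallyOpposingArcs : POGraph n → Set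
TwoMinimallyOpposingArcs {n} X =
  Σ (Fin n) λ a → Σ (Fin n) λ b → Σ (Fin n) λ c → Σ (Fin n) λ d →
    ExactlyTwoArcs X a b c d × Opposing X a b c d × NotOpposingAfterDeletion X a b c d

unorient-arc⇔ : ∀ (H : POGraph n) {x y a b} →
                T (arc (unorient H x y) a b) ⇔ (T (arc H a b) × (a , b) ≢ (x , y))
unorient-arc⇔ H {x} {y} {a} {b} with a ≟ x | b ≟ y
... | yes refl | yes refl =
  mk⇔ (λ t → ⊥-elim (proj₂ (to (T-∧ {arc H a b}) t))) (λ (_ , ab≢xy) → ⊥-elim (ab≢xy refl))
... | yes _ | no b≢y =
  mk⇔ (λ t → proj₁ (to (T-∧ {arc H a b}) t) , b≢y ∘ cong proj₂)
      (λ (ab , _) → from (T-∧ {arc H a b}) (ab , tt))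
... | no a≢x | _ =
  mk⇔ (λ t → proj₁ (to (T-∧ {arc H a b}) t) , a≢x ∘ cong proj₁)
      (λ (ab , _) → from (T-∧ {arc H a b}) (ab , tt))

unique-other-of-two : ∀ {A : Set} {P Q p q r : A} →
                      p ≡ P ⊎ p ≡ Q → q ≡ P ⊎ q ≡ Q → r ≡ P ⊎ r ≡ Q → p ≢ r → q ≢ r → p ≡ q
unique-other-of-two (inj₁ refl) (inj₁ refl) _           _   _   = refl
unique-other-of-two (inj₂ refl) (inj₂ refl) _           _   _   = refl
unique-other-of-two (inj₁ refl) (inj₂ refl) (inj₁ refl) p≢r _   = ⊥-elim (p≢r refl)
unique-other-of-two (inj₁ refl) (inj₂ refl) (inj₂ refl) _   q≢r = ⊥-elim (q≢r refl)
unique-other-of-two (inj₂ refl) (inj₁ refl) (inj₁ refl) _   q≢r = ⊥-elim (q≢r refl)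
unique-other-of-two (inj₂ refl) (inj₁ refl) (inj₂ refl) p≢r _   = ⊥-elim (p≢r refl)

opposing-images : ∀ {G : Graph n} {B : Set} {f : Pair n → B} {P Q : B} →
                  LTOrientable G → (∀ {p q} → f p ≡ f q → p ≡ q) →
                  ∀ {p q} → f p ≡ P ⊎ f p ≡ Q → f q ≡ P ⊎ f q ≡ Q → Γ* G p (swap q) →
                  ∃₂ λ P′ Q′ → f P′ ≡ P × f Q′ ≡ Q × Γ* G P′ (swap Q′)
opposing-images         lto f-injective (inj₁ p↦P) (inj₂ q↦Q) g = _ , _ , p↦P , q↦Q , g
opposing-images {G = G} lto f-injective (inj₂ p↦Q) (inj₁ q↦P) g = _ , _ , q↦P , p↦Q , Γ*-swap G g
opposing-images         lto f-injective (inj₁ p↦P) (inj₁ q↦P) g =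
  ⊥-elim (¬Γ*-swap lto (subst (λ q → Γ* _ _ (swap q)) (f-injective (trans q↦P (≡-sym p↦P))) g))
opposing-images         lto f-injective (inj₂ p↦Q) (inj₂ q↦Q) g =
  ⊥-elim (¬Γ*-swap lto (subst (λ q → Γ* _ _ (swap q)) (f-injective (trans q↦Q (≡-sym p↦Q))) g))

deletionsCompletable⇒notOpposingAfterDeletion :
  ∀ (X : POGraph n) → DeletionsCompletable X →
  ∀ {a b c d} → T (arc X a b) → T (arc X c d) → NotOpposingAfterDeletion X a b c d
deletionsCompletable⇒notOpposingAfterDeletion {zero}  X _         _  _  = tt
deletionsCompletable⇒notOpposingAfterDeletion {suc n} X deletable ab cd
  v a′ b′ c′ d′ refl refl refl refl =
  Completable⇒¬Opposing (X - v) (deletable v) {a′ , b′} {c′ , d′} ab cd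

notOpposingAfterDeletion⇒deletionsCompletable :
  ∀ (X : POGraph n) → LTOrientable (U X) → ∀ {a b c d} →
  ArcsWithin X (a , b) (c , d) → NotOpposingAfterDeletion X a b c d → DeletionsCompletable X
notOpposingAfterDeletion⇒deletionsCompletable {zero}  X _   _      _   = tt
notOpposingAfterDeletion⇒deletionsCompletable {suc n} X lto within nad v
  with completable-or-opposing (X - v) (restrict-LTOrientable {G = U X} v lto)
... | inj₁ C = C
... | inj₂ (p′ , q′ , p′-arc , q′-arc , g)
  with opposing-images (restrict-LTOrientable {G = U X} v lto) (punchIn²-injective v)
         (within _ _ p′-arc) (within _ _ q′-arc) g
...   | (a′ , b′) , (c′ , d′) , ab , cd , g′ =
  ⊥-elim (nad v a′ b′ c′ d′ (proj₁ (,-injective ab)) (proj₂ (,-injective ab))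
                            (proj₁ (,-injective cd)) (proj₂ (,-injective cd)) g′)

arcsWithin⇒arcMinimal : ∀ (X : POGraph n) → LTOrientable (U X) → ∀ {P Q} → ArcsWithin X P Q →
                        ∀ (u v : Fin n) → T (arc X u v) → Completable (unorient X u v)
arcsWithin⇒arcMinimal X lto within u v uv with completable-or-opposing (unorient X u v) lto
... | inj₁ C = C
... | inj₂ ((a , b) , (c , d) , ab , cd , g)
  with to (unorient-arc⇔ X {u} {v} {a} {b}) ab | to (unorient-arc⇔ X {u} {v} {c} {d}) cd
...   | ab′ , ab≢uv | cd′ , cd≢uv =
  ⊥-elim (¬Γ*-swap lto (subst (λ q → Γ* (U X) (a , b) (swap q)) (≡-sym ab≡cd) g))
  where
  ab≡cd : (a , b) ≡ (c , d)
  ab≡cd = unique-other-of-two (within a b ab′) (within c d cd′) (within u v uv) ab≢uv cd≢uv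

arcMinimal⇒arcsWithin : ∀ (X : POGraph n) → (∀ u v → T (arc X u v) → Completable (unorient X u v)) →
                        ∀ {a b c d} → T (arc X a b) → T (arc X c d) → Opposing X a b c d →
                        ArcsWithin X (a , b) (c , d)
arcMinimal⇒arcsWithin X minimal {a} {b} {c} {d} ab cd g x y xy
  with ≡-dec _≟_ _≟_ (x , y) (a , b) | ≡-dec _≟_ _≟_ (x , y) (c , d)
... | yes e     | _         = inj₁ e
... | no _      | yes e     = inj₂ e
... | no xy≢ab | no xy≢cd =
  ⊥-elim (Completable⇒¬Opposing (unorient X x y) (minimal x y xy) {a , b} {c , d}
    (from (unorient-arc⇔ X) (ab , xy≢ab ∘ ≡-sym)) (from (unorient-arc⇔ X) (cd , xy≢cd ∘ ≡-sym)) g)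

obstruction⇒twoMinimallyOpposingArcs : ∀ (X : POGraph n) → LTOrientable (U X) →
                                       Obstruction X → TwoMinimallyOpposingArcs X
obstruction⇒twoMinimallyOpposingArcs X lto ob with completable-or-opposing X lto
... | inj₁ C = ⊥-elim (Obstruction.not-completable ob C)
... | inj₂ ((a , b) , (c , d) , ab , cd , g) =
  a , b , c , d ,
  (ab , cd , distinct , arcMinimal⇒arcsWithin X (Obstruction.arc-minimal ob) ab cd g) , g ,
  deletionsCompletable⇒notOpposingAfterDeletion X (Obstruction.vertex-minimal ob) ab cd
  where
  distinct : (a , b) ≢ (c , d)
  distinct refl = ¬Γ*-swap lto g

twoMinimallyOpposingArcs⇒obstruction : ∀ (X : POGraph n) → LTOrientable (U X) →
                                       TwoMinimallyOpposingArcs X → Obstruction X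
twoMinimallyOpposingArcs⇒obstruction X lto (a , b , c , d , (ab , cd , _ , within) , g , nad) = record
  { not-completable = λ C → Completable⇒¬Opposing X C {a , b} {c , d} ab cd g
  ; vertex-minimal  = notOpposingAfterDeletion⇒deletionsCompletable X lto within nad
  ; arc-minimal     = arcsWithin⇒arcMinimal X lto within
  }

obstruction⇒Γ-sequences-cover :
  ∀ (X : POGraph n) → Obstruction X → ∀ (a b c d : Fin n) → ExactlyTwoArcs X a b c d →
  ∀ ps → GSeq (U X) (a , b) (d , c) ps → ∀ (w : Fin n) → Occurs w ps
obstruction⇒Γ-sequences-cover {suc n} X ob a b c d (ab , cd , _) ps s w
  with Any.any? (λ p → (w ≟ proj₁ p) ⊎-dec (w ≟ proj₂ p)) ps
... | yes w∈ps = w∈ps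
... | no w∉ps
  with punchIn²-onto (w∉ps ∘ Occurs-first (U X) s) | punchIn²-onto (w∉ps ∘ Occurs-last (U X) s)
...   | (a′ , b′) , refl | (d′ , c′) , refl =
  ⊥-elim (Completable⇒¬Opposing (X - w) (Obstruction.vertex-minimal ob w) {a′ , b′} {c′ , d′} ab cd
    (GSeq-delete (U X) w s w∉ps refl refl))

theorem2p7 : ∀ (n : ℕ) (X : POGraph n) → LTOrientable (U X) →
    (Obstruction X ⇔
      Σ (Fin n) λ a → Σ (Fin n) λ b → Σ (Fin n) λ c → Σ (Fin n) λ d →
        ExactlyTwoArcs X a b c d × Opposing X a b c d × NotOpposingAfterDeletion X a b c d) ×
    (Obstruction X → ∀ (a b c d : Fin n) → ExactlyTwoArcs X a b c d →
      ∀ ps → GSeq (U X) (a , b) (d , c) ps → ∀ (w : Fin n) → Occurs w ps)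
theorem2p7 n X lto =
  mk⇔ (obstruction⇒twoMinimallyOpposingArcs X lto) (twoMinimallyOpposingArcs⇒obstruction X lto) ,
  obstruction⇒Γ-sequences-cover X
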